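{- Let $G$ be a graph without isolated vertices. If $\{G_1,G_2\}$ is a stable separation of $G$, then colouring all edges of $G_1$ red and all edges of $G_2$ blue yields a NAP-colouring of $G$. Conversely, if $c\colon E(G)\to\{\mathrm{red},\mathrm{blue}\}$ is a NAP-colouring of $G$, then $\{G_{\mathrm{red}},G_{\mathrm{blue}}\}$ is a stable separation of $G$, where $G_{\mathrm{red}}$ and $G_{\mathrm{blue}}$ are the subgraphs of $G$ induced by the red edges and by the blue edges, respectively.
   Context: For $E'\subseteq E(G)$, $G[E']$ denotes the edge-induced subgraph (the minimal subgraph containing $E'$). A separation of a graph $G$ without isolated vertices is a pair of subgraphs $\{G_1,G_2\}$ such that there is a partition $\{E_1,E_2\}$ of $E(G)$ with $G_1=G[E_1]$, $G_2=G[E_2]$, $V(G_1)\setminus V(G_2)\neq\varnothing$ and $V(G_2)\setminus V(G_1)\neq\varnothing$. It is stable if $V(G_1)\cap V(G_2)$ is a set of pairwise nonadjacent vertices of $G$. For an edge colouring $c\colon E(G)\to\{\mathrm{red},\mathrm{blue}\}$, a path $(u_1,u_2,u_3,u_4)$ of length $3$ is alternating if $c(u_1u_2)\neq c(u_2u_3)\neq c(u_3u_4)$. A NAP-colouring is a surjective colouring $c\colon E(G)\to\{\mathrm{red},\mathrm{blue}\}$ such that every $3$-cycle of $G$ is monochromatic and there is no alternating path of length $3$ in $G$. -}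

module Defs where

open import Data.Nat using (ℕ)
open import Data.Fin using (Fin)
open import Data.Bool using (Bool; true; false; if_then_else_; _∧_)
open import Data.Product using (Σ; ∃; _×_; _,_)
open import Data.Sum using (_⊎_)
open import Relation.Nullary using (¬_)
open import Relation.Binary.PropositionalEquality using (_≡_; _≢_)

record Graph : Set where
  field
    n         : ℕ
    adj       : Fin n → Fin n → Bool
    adj-sym   : ∀ u v → adj u v ≡ adj v u
    adj-irref : ∀ v → adj v v ≡ false

open Graph public

Edge : (G : Graph) → Fin (n G) → Fin (n G) → Set
Edge G u v = adj G u v ≡ true

NoIsolatedVertices : Graph → Set
NoIsolatedVertices G = ∀ v → ∃ λ u → Edge G v u

EdgeSet : Graph → Set
EdgeSet G = Fin (n G) → Fin (n G) → Bool

IsEdgeSubset : (G : Graph) → EdgeSet G → Set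
IsEdgeSubset G E = (∀ u v → E u v ≡ E v u) × (∀ u v → E u v ≡ true → Edge G u v)

-- Vertex set of the edge-induced subgraph G[E']: vertices incident to an edge of E'
InV : (G : Graph) → EdgeSet G → Fin (n G) → Set
InV G E x = ∃ λ y → E x y ≡ true

IsPartition : (G : Graph) → EdgeSet G → EdgeSet G → Set
IsPartition G E₁ E₂ =
  IsEdgeSubset G E₁ × IsEdgeSubset G E₂ ×
  (∀ u v → Edge G u v →
     (E₁ u v ≡ true × E₂ u v ≡ false) ⊎ (E₁ u v ≡ false × E₂ u v ≡ true))

IsSeparation : (G : Graph) → EdgeSet G → EdgeSet G → Set
IsSeparation G E₁ E₂ =
  IsPartition G E₁ E₂ ×
  (∃ λ x → InV G E₁ x × ¬ InV G E₂ x) ×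
  (∃ λ y → InV G E₂ y × ¬ InV G E₁ y)

IsStableSep : (G : Graph) → EdgeSet G → EdgeSet G → Set
IsStableSep G E₁ E₂ =
  IsSeparation G E₁ E₂ ×
  (∀ u v → InV G E₁ u → InV G E₂ u → InV G E₁ v → InV G E₂ v → ¬ Edge G u v)

data Colour : Set where
  red blue : Colour

-- An edge colouring: a colour for each (ordered) pair, required to be
-- symmetric on edges; values on non-edges are irrelevant.
Colouring : Graph → Set
Colouring G = Fin (n G) → Fin (n G) → Colour

IsEdgeColouring : (G : Graph) → Colouring G → Set
IsEdgeColouring G c = ∀ u v → Edge G u v → c u v ≡ c v u

Surjective : (G : Graph) → Colouring G → Set
Surjective G c =
  (∃ λ u → ∃ λ v → Edge G u v × c u v ≡ red) ×
  (∃ λ u → ∃ λ v → Edge G u v × c u v ≡ blue)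

TrianglesMonochromatic : (G : Graph) → Colouring G → Set
TrianglesMonochromatic G c =
  ∀ u v w → Edge G u v → Edge G v w → Edge G u w →
    (c u v ≡ c v w) × (c v w ≡ c u w)

IsPath3 : (G : Graph) → (u₁ u₂ u₃ u₄ : Fin (n G)) → Set
IsPath3 G u₁ u₂ u₃ u₄ =
  Edge G u₁ u₂ × Edge G u₂ u₃ × Edge G u₃ u₄ ×
  u₁ ≢ u₂ × u₁ ≢ u₃ × u₁ ≢ u₄ × u₂ ≢ u₃ × u₂ ≢ u₄ × u₃ ≢ u₄

IsAlternating : (G : Graph) → Colouring G → (u₁ u₂ u₃ u₄ : Fin (n G)) → Set
IsAlternating G c u₁ u₂ u₃ u₄ =
  IsPath3 G u₁ u₂ u₃ u₄ × c u₁ u₂ ≢ c u₂ u₃ × c u₂ u₃ ≢ c u₃ u₄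

NoAlternatingPath : (G : Graph) → Colouring G → Set
NoAlternatingPath G c = ∀ u₁ u₂ u₃ u₄ → ¬ IsAlternating G c u₁ u₂ u₃ u₄

IsNAP : (G : Graph) → Colouring G → Set
IsNAP G c =
  IsEdgeColouring G c × Surjective G c ×
  TrianglesMonochromatic G c × NoAlternatingPath G c

sepColouring : (G : Graph) → EdgeSet G → Colouring G
sepColouring G E₁ u v = if E₁ u v then red else blue

isRed : Colour → Bool
isRed red  = true
isRed blue = false

isBlue : Colour → Bool
isBlue red  = false
isBlue blue = true

redEdges : (G : Graph) → Colouring G → EdgeSet G
redEdges G c u v = adj G u v ∧ isRed (c u v)

blueEdges : (G : Graph) → Colouring G → EdgeSet G
blueEdges G c u v = adj G u v ∧ isBlue (c u v)

{-# OPTIONS --safe #-}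
-- Call a vertex bicoloured if it is incident with edges of both colours. For any edge
-- colouring, monochromatic triangles and no alternating paths together say exactly that the
-- bicoloured vertices are pairwise nonadjacent: the two inner vertices of an alternating
-- path are adjacent and bicoloured, and so are two corners of a non-monochromatic
-- triangle; conversely, an a-edge between bicoloured vertices extends at both ends by
-- b-edges to an alternating path, or to a non-monochromatic triangle if the two
-- extensions meet. For the colouring of a separation, bicoloured vertices lie in
-- V(G₁) ∩ V(G₂); for G_red and G_blue that intersection consists exactly of the
-- bicoloured vertices, and some endpoint of each red (blue) edge is not bicoloured, so it
-- lies only in G_red (G_blue).
module Submission where

open import Defs
open import Data.Bool using (Bool; true; false; _∧_)
import Data.Bool as Bool
open import Data.Bool.Properties using (∧-conicalˡ; ∧-conicalʳ)
open import Data.Empty using (⊥; ⊥-elim)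
open import Data.Fin using (Fin)
import Data.Fin as Fin
open import Data.Fin.Properties using (any?)
open import Data.Product using (_×_; _,_; ∃; proj₁; proj₂)
open import Data.Sum using (_⊎_; inj₁; inj₂)
open import Function using (_∘_)
open import Relation.Nullary using (¬_; Dec; yes; no)
open import Relation.Nullary.Decidable using (_×-dec_)
open import Relation.Binary.PropositionalEquality

_≟ᶜ_ : (a b : Colour) → Dec (a ≡ b)
red  ≟ᶜ red  = yes refl
red  ≟ᶜ blue = no λ ()
blue ≟ᶜ red  = no λ ()
blue ≟ᶜ blue = yes refl

isColour : Colour → Colour → Bool
isColour red  = isRed
isColour blue = isBlue

isColour-refl : ∀ a → isColour a a ≡ true
isColour-refl red  = refl
isColour-refl blue = refl

isColour⇒≡ : ∀ {a b} → isColour a b ≡ true → b ≡ a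
isColour⇒≡ {red}  {red}  _ = refl
isColour⇒≡ {blue} {blue} _ = refl
isColour⇒≡ {red}  {blue} ()
isColour⇒≡ {blue} {red}  ()

module _ (G : Graph) where

  private
    variable
      u v x y z : Fin (n G)
      a b : Colour

  Edge-sym : Edge G u v → Edge G v u
  Edge-sym {u} {v} e = trans (adj-sym G v u) e

  Edge⇒≢ : Edge G u v → u ≢ v
  Edge⇒≢ {u} e refl with () ← trans (sym (adj-irref G u)) e

  module _ (c : Colouring G) where

    Sees : Fin (n G) → Colour → Set
    Sees x a = ∃ λ y → Edge G x y × c x y ≡ a

    sees? : ∀ x a → Dec (Sees x a)
    sees? x a = any? λ y → (adj G x y Bool.≟ true) ×-dec (c x y ≟ᶜ a)

    Bicoloured : Fin (n G) → Set
    Bicoloured x = Sees x red × Sees x blue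

    bicoloured : Sees x a → Sees x b → a ≢ b → Bicoloured x
    bicoloured {a = red}  {b = blue} s t _   = s , t
    bicoloured {a = blue} {b = red}  s t _   = t , s
    bicoloured {a = red}  {b = red}  _ _ a≢b = ⊥-elim (a≢b refl)
    bicoloured {a = blue} {b = blue} _ _ a≢b = ⊥-elim (a≢b refl)

    BicolouredIndependent : Set
    BicolouredIndependent = ∀ {u v} → Bicoloured u → Bicoloured v → ¬ Edge G u v

    module _ (c-sym : IsEdgeColouring G c) where

      sees-forth : Edge G x y → Sees x (c x y)
      sees-forth {y = y} e = y , e , refl

      sees-back : Edge G x y → Sees y (c x y)
      sees-back {x} {y} e = x , Edge-sym e , sym (c-sym x y e)

      module _ (indep : BicolouredIndependent) where

        corner-monochromatic : Edge G x y → Edge G x z → Edge G y z → c x y ≡ c x z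
        corner-monochromatic {x} {y} {z} exy exz eyz with c x y ≟ᶜ c x z | c y z ≟ᶜ c x y
        ... | yes xy≡xz | _        = xy≡xz
        ... | no xy≢xz | no yz≢xy  =
          ⊥-elim (indep (bicoloured (sees-forth exy) (sees-forth exz) xy≢xz)
                        (bicoloured (sees-forth eyz) (sees-back exy) yz≢xy) exy)
        ... | no xy≢xz | yes yz≡xy =
          ⊥-elim (indep (bicoloured (sees-forth exy) (sees-forth exz) xy≢xz)
                        (bicoloured (sees-back eyz) (sees-back exz) (xy≢xz ∘ trans (sym yz≡xy))) exz)

        bicolouredIndependent⇒trianglesMonochromatic : TrianglesMonochromatic G c
        bicolouredIndependent⇒trianglesMonochromatic u v w euv evw euw =
          trans (c-sym u v euv) (corner-monochromatic (Edge-sym euv) evw euw) ,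
          trans (c-sym v w evw) (trans (corner-monochromatic (Edge-sym evw) (Edge-sym euw) (Edge-sym euv))
                                       (sym (c-sym u w euw)))

        bicolouredIndependent⇒noAlternatingPath : NoAlternatingPath G c
        bicolouredIndependent⇒noAlternatingPath _ _ _ _ ((e₁₂ , e₂₃ , e₃₄ , _) , ≢₁₂₃ , ≢₂₃₄) =
          indep (bicoloured (sees-back e₁₂) (sees-forth e₂₃) ≢₁₂₃)
                (bicoloured (sees-back e₂₃) (sees-forth e₃₄) ≢₂₃₄) e₂₃

        exclusive-endpoint : Edge G u v → c u v ≡ a → a ≢ b → ∃ λ x → Sees x a × ¬ Sees x b
        exclusive-endpoint {u} {v} {b = b} euv refl a≢b with sees? u b | sees? v b
        ... | no ¬ub | _      = u , sees-forth euv , ¬ub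
        ... | yes _  | no ¬vb = v , sees-back euv , ¬vb
        ... | yes ub | yes vb =
          ⊥-elim (indep (bicoloured (sees-forth euv) ub a≢b) (bicoloured (sees-back euv) vb a≢b) euv)

      -- An a-edge uv with b-edges uw and vz is the middle of the alternating path w u v z,
      -- unless w = z, when u v w is a triangle that is not monochromatic.
      no-flanked-edge : TrianglesMonochromatic G c → NoAlternatingPath G c →
                        Edge G u v → c u v ≡ a → a ≢ b → Sees u b → Sees v b → ⊥
      no-flanked-edge {u} {v} tri noAlt euv refl a≢b (w , euw , refl) (z , evz , vz≡uw) with w Fin.≟ z
      ... | yes refl = a≢b (trans (proj₁ t) (proj₂ t)) where t = tri u v w euv evz euw
      ... | no w≢z   = noAlt w u v z
        ( ( Edge-sym euw , euv , evz
          , Edge⇒≢ (Edge-sym euw) , (λ { refl → a≢b refl }) , w≢z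
          , Edge⇒≢ euv , (λ { refl → a≢b (trans (c-sym u v euv) vz≡uw) }) , Edge⇒≢ evz )
        , (λ wu≡uv → a≢b (sym (trans (c-sym u w euw) wu≡uv)))
        , (λ uv≡vz → a≢b (trans uv≡vz vz≡uw)) )

      nap⇒bicolouredIndependent : TrianglesMonochromatic G c → NoAlternatingPath G c →
                                  BicolouredIndependent
      nap⇒bicolouredIndependent tri noAlt {u} {v} (ru , bu) (rv , bv) euv with c u v in uv-colour
      ... | red  = no-flanked-edge tri noAlt euv uv-colour (λ ()) bu bv
      ... | blue = no-flanked-edge tri noAlt euv uv-colour (λ ()) ru rv

  module _ (E₁ E₂ : EdgeSet G) where

    module _ (part : IsPartition G E₁ E₂) where

      sepColouring-isEdgeColouring : IsEdgeColouring G (sepColouring G E₁)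
      sepColouring-isEdgeColouring u v _ rewrite proj₁ (proj₁ part) u v = refl

      sees-red⇒InV₁ : Sees (sepColouring G E₁) x red → InV G E₁ x
      sees-red⇒InV₁ {x} (y , _ , _) with E₁ x y in E₁xy
      ... | true = y , E₁xy

      sees-blue⇒InV₂ : Sees (sepColouring G E₁) x blue → InV G E₂ x
      sees-blue⇒InV₂ {x} (y , exy , _) with E₁ x y | proj₂ (proj₂ part) x y exy
      ... | false | inj₂ (_ , E₂xy) = y , E₂xy
      ... | false | inj₁ (() , _)

    separation⇒surjective : IsSeparation G E₁ E₂ → Surjective G (sepColouring G E₁)
    separation⇒surjective (part , (x , (y , E₁xy) , _) , (x' , (y' , E₂x'y') , x'∉V₁)) =
      (x , y , proj₂ (proj₁ part) x y E₁xy , red-xy) ,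
      (x' , y' , proj₂ (proj₁ (proj₂ part)) x' y' E₂x'y' , blue-x'y')
      where
      red-xy : sepColouring G E₁ x y ≡ red
      red-xy rewrite E₁xy = refl
      blue-x'y' : sepColouring G E₁ x' y' ≡ blue
      blue-x'y' with E₁ x' y' in E₁x'y'
      ... | true  = ⊥-elim (x'∉V₁ (y' , E₁x'y'))
      ... | false = refl

    stableSep⇒bicolouredIndependent : IsStableSep G E₁ E₂ → BicolouredIndependent (sepColouring G E₁)
    stableSep⇒bicolouredIndependent ((part , _) , stable) (ru , bu) (rv , bv) =
      stable _ _ (sees-red⇒InV₁ part ru) (sees-blue⇒InV₂ part bu)
                 (sees-red⇒InV₁ part rv) (sees-blue⇒InV₂ part bv)

    stableSep⇒NAP : IsStableSep G E₁ E₂ → IsNAP G (sepColouring G E₁)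
    stableSep⇒NAP S@((part , _) , _) =
      c-sym , separation⇒surjective (proj₁ S) ,
      bicolouredIndependent⇒trianglesMonochromatic c c-sym indep ,
      bicolouredIndependent⇒noAlternatingPath c c-sym indep
      where
      c = sepColouring G E₁
      c-sym = sepColouring-isEdgeColouring part
      indep = stableSep⇒bicolouredIndependent S

  module _ (c : Colouring G) where

    -- colourEdges red and colourEdges blue unfold to redEdges G c and blueEdges G c.
    colourEdges : Colour → EdgeSet G
    colourEdges a u v = adj G u v ∧ isColour a (c u v)

    colourEdges⇒ : colourEdges a u v ≡ true → Edge G u v × c u v ≡ a
    colourEdges⇒ {a} {u} {v} p =
      ∧-conicalˡ (adj G u v) _ p , isColour⇒≡ (∧-conicalʳ _ (isColour a (c u v)) p)

    ⇒colourEdges : Edge G u v → c u v ≡ a → colourEdges a u v ≡ true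
    ⇒colourEdges {a = a} e refl rewrite e = isColour-refl a

    InV-colourEdges⇒Sees : InV G (colourEdges a) x → Sees c x a
    InV-colourEdges⇒Sees (y , p) = y , colourEdges⇒ p

    Sees⇒InV-colourEdges : Sees c x a → InV G (colourEdges a) x
    Sees⇒InV-colourEdges (y , e , p) = y , ⇒colourEdges e p

    colourEdges-isEdgeSubset : IsEdgeColouring G c → IsEdgeSubset G (colourEdges a)
    colourEdges-isEdgeSubset {a} c-sym = colourEdges-sym , λ _ _ → proj₁ ∘ colourEdges⇒ {a}
      where
      colourEdges-sym : ∀ u v → colourEdges a u v ≡ colourEdges a v u
      colourEdges-sym u v with adj G u v in e
      ... | true  rewrite Edge-sym e = cong (isColour a) (c-sym u v e)
      ... | false rewrite trans (adj-sym G v u) e = refl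

    colourEdges-partition : IsEdgeColouring G c → IsPartition G (colourEdges red) (colourEdges blue)
    colourEdges-partition c-sym =
      colourEdges-isEdgeSubset {red} c-sym , colourEdges-isEdgeSubset {blue} c-sym , red-or-blue
      where
      red-or-blue : ∀ u v → Edge G u v →
        (colourEdges red u v ≡ true × colourEdges blue u v ≡ false) ⊎
        (colourEdges red u v ≡ false × colourEdges blue u v ≡ true)
      red-or-blue u v e rewrite e with c u v
      ... | red  = inj₁ (refl , refl)
      ... | blue = inj₂ (refl , refl)

    NAP⇒stableSep : IsNAP G c → IsStableSep G (colourEdges red) (colourEdges blue)
    NAP⇒stableSep (c-sym , ((_ , _ , e , red-e) , (_ , _ , e' , blue-e')) , tri , noAlt) =
      (colourEdges-partition c-sym , exclusive {b = blue} e red-e (λ ()) , exclusive {b = red} e' blue-e' (λ ())) ,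
      λ _ _ ru bu rv bv →
        indep (InV-colourEdges⇒Sees ru , InV-colourEdges⇒Sees bu)
              (InV-colourEdges⇒Sees rv , InV-colourEdges⇒Sees bv)
      where
      indep = nap⇒bicolouredIndependent c c-sym tri noAlt
      exclusive : Edge G x y → c x y ≡ a → a ≢ b →
                  ∃ λ z → InV G (colourEdges a) z × ¬ InV G (colourEdges b) z
      exclusive e p a≢b with exclusive-endpoint c c-sym indep e p a≢b
      ... | z , sees-a , ¬sees-b = z , Sees⇒InV-colourEdges sees-a , ¬sees-b ∘ InV-colourEdges⇒Sees

lemma4p9 : (G : Graph) → NoIsolatedVertices G →
    ((E₁ E₂ : EdgeSet G) → IsStableSep G E₁ E₂ → IsNAP G (sepColouring G E₁)) ×
    ((c : Colouring G) → IsNAP G c → IsStableSep G (redEdges G c) (blueEdges G c))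
lemma4p9 G _ = stableSep⇒NAP G , NAP⇒stableSep G
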